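{- Let $G=(V,E)$ be a graph on $N$ vertices which is $N/8$-dense in $K_N$, whose edges are coloured with three colours, and let $F_1=(V_1,E_1)$ and $F_2=(V_2,E_2)$ be monochromatic components of the first and the second colour, respectively. Then either there exists a monochromatic component of the third colour which contains a matching saturating $N/2$ vertices, or $$\min\{|V_1\setminus V_2|,\,|V_2\setminus V_1|\}<N/4.$$ In particular, if $G$ contains no monochromatic component with a matching saturating at least $N/2$ vertices, then any two monochromatic components of different colours, each with at least $N/2$ vertices, share more than $N/4$ vertices.
   Context: A subgraph $G$ of a graph $H$ is $b$-dense in $H$ if for every vertex $v$, $\deg_H(v)-\deg_G(v)<b$; $G$ on $N$ vertices being $b$-dense in $K_N$ means every vertex of $G$ has fewer than $b$ non-neighbours besides itself. A monochromatic component of colour $i$ is a connected component of the spanning subgraph formed by the edges of colour $i$; a matching in it uses edges of colour $i$ of that component. A matching saturates $k$ vertices if it covers $k$ vertices. -}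

module Defs where

open import Data.Nat using (ℕ; _*_; _<_; _≤_)
open import Data.Fin using (Fin; zero; suc)
open import Data.Fin.Properties using (_≟_)
open import Data.Fin.Subset using (Subset; _∈_; ∣_∣)
open import Data.Bool using (Bool; not; _∧_)
open import Data.Maybe using (Maybe; just; nothing; is-nothing)
open import Data.Vec using (tabulate)
open import Data.List using (List; []; _∷_; length)
open import Data.List.Relation.Unary.All using (All)
open import Data.List.Relation.Unary.Unique.Propositional using (Unique)
open import Data.Product using (_×_; _,_; ∃)
open import Relation.Binary.PropositionalEquality using (_≡_)
open import Relation.Binary.Construct.Closure.ReflexiveTransitive using (Star)
open import Relation.Nullary.Decidable using (⌊_⌋)

-- A graph G on vertex set Fin N whose edges are 3-coloured:
-- col u v ≡ nothing  means uv is not an edge of G,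
-- col u v ≡ just i   means uv is an edge of G of colour i.
record ColouredGraph (N : ℕ) : Set where
  field
    col   : Fin N → Fin N → Maybe (Fin 3)
    sym   : ∀ u v → col u v ≡ col v u
    irrefl : ∀ v → col v v ≡ nothing
open ColouredGraph public

Edge : ∀ {N} → ColouredGraph N → Fin 3 → Fin N → Fin N → Set
Edge G i u v = col G u v ≡ just i

nonNbrs : ∀ {N} → ColouredGraph N → Fin N → Subset N
nonNbrs G v = tabulate (λ u → not ⌊ u ≟ v ⌋ ∧ is-nothing (col G v u))

-- G is b-dense in K_N (with b = N/8): every vertex has fewer than N/8
-- non-neighbours besides itself, i.e. 8 * #nonneighbours < N.
Dense8 : ∀ {N} → ColouredGraph N → Set
Dense8 {N} G = ∀ v → 8 * ∣ nonNbrs G v ∣ < N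

IsMonoComponent : ∀ {N} → ColouredGraph N → Fin 3 → Subset N → Set
IsMonoComponent {N} G i S =
  ∃ (λ (w : Fin N) → w ∈ S)
  × (∀ u v → u ∈ S → Edge G i u v → v ∈ S)
  × (∀ u v → u ∈ S → v ∈ S → Star (Edge G i) u v)

covered : ∀ {N} → List (Fin N × Fin N) → List (Fin N)
covered [] = []
covered ((u , v) ∷ es) = u ∷ v ∷ covered es

IsMatchingIn : ∀ {N} → ColouredGraph N → Fin 3 → Subset N → List (Fin N × Fin N) → Set
IsMatchingIn G i S M =
  All (λ e → Edge G i (Data.Product.proj₁ e) (Data.Product.proj₂ e)
             × Data.Product.proj₁ e ∈ S × Data.Product.proj₂ e ∈ S) M
  × Unique (covered M)

-- S (a colour-i component) contains a matching saturating at least N/2 vertices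
-- (it saturates 2 * length M vertices; 2 * (2 * |M|) ≥ N  iff  2|M| ≥ N/2).
HasBigMatching : ∀ {N} → ColouredGraph N → Fin 3 → Subset N → Set
HasBigMatching {N} G i S =
  ∃ (λ M → IsMatchingIn G i S M × N ≤ 2 * (2 * length M))

-- Let V₁, V₂ be components of colours i ≠ j and k the third colour. Suppose both
-- A = V₁ ∖ V₂ and B = V₂ ∖ V₁ have at least N/4 vertices (otherwise the first claim holds).
-- An A–B edge cannot have colour i or j (it would drag its end into the other component),
-- so all A–B edges have colour k. In such a bipartite situation:
--   * any two vertices of A have a common colour-k neighbour in B, since together they
--     miss fewer than N/4 ≤ |B| vertices; so A lies in one colour-k component;
--   * a colour-k A–B matching with fewer than N/4 edges can always be enlarged: for
--     unmatched a ∈ A, b ∈ B either a or b has an unmatched neighbour, or some matching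
--     edge a′b′ with a ~ b′ and a′ ~ b can be exchanged for a′b, ab′; if neither happens,
--     counting neighbours along the matching gives |A| + |B| < N/2, a contradiction.
-- Iterating gives a matching saturating N/2 vertices inside the component of A.
-- The second claim follows from the first by |A| = |A ∖ B| + |A ∩ B| and arithmetic.

module Submission where

open import Defs hiding (sym)
open import Data.Nat using (ℕ; zero; suc; _+_; _*_; _<_; _≤_; _⊓_; z≤n; s≤s; _<?_)
open import Data.Nat.Properties
open import Data.Bool using (Bool; true; not; _∧_)
open import Data.Fin using (Fin; zero; suc)
open import Data.Fin.Properties using (any?; injective⇒≤; toℕ<n) renaming (_≟_ to _≟ᶠ_)
open import Data.Fin.Subset using (Subset; _∈_; _∉_; ∣_∣; _─_; _∩_; _∪_; ⁅_⁆; Nonempty; inside; outside) renaming (⊥ to ∅)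
open import Data.Fin.Subset.Properties using (_∈?_; ∣p∣≤n; p⊂q⇒∣p∣<∣q∣; nonempty?; Empty-unique; ∣⊥∣≡0; p⊆q⇒∣p∣≤∣q∣; ∩-comm; x∈p∪q⁺; x∈p∪q⁻; x∈⁅x⁆; x∈⁅y⁆⇒x≡y; ∣⁅x⁆∣≡1)
open import Data.Vec using (_∷_; []; lookup; tabulate) renaming (here to headᵛ; there to tailᵛ)
open import Data.Vec.Properties using (lookup∘tabulate; lookup⇒[]=)
open import Data.List using (List; []; _∷_; length; foldr; _++_; map; filter)
open import Data.List.Properties using (map-++; length-map; length-++-sucʳ)
open import Function using (_∘_)
open import Data.List.Membership.Propositional using () renaming (_∈_ to _∈ₗ_; _∉_ to _∉ₗ_)
open import Data.List.Relation.Unary.Any using (here; there) renaming (any? to anyₗ?)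
open import Data.List.Relation.Unary.All using (All; []; _∷_)
import Data.List.Relation.Unary.All as All
open import Data.List.Relation.Unary.All.Properties using (¬Any⇒All¬; All¬⇒¬Any) renaming (++⁺ to All-++⁺; ++⁻ to All-++⁻)
open import Data.List.Relation.Unary.Unique.Propositional using (Unique)
open import Data.List.Relation.Unary.AllPairs using ([]; _∷_)
open import Data.List.Membership.Propositional.Properties using (∈-++⁺ˡ; ∈-++⁺ʳ; ∈-++⁻; ∈-map⁻; ∈-map∘filter⁺; ∈-∃++)
open import Data.List.Membership.Propositional using (find)
open import Data.Product using (Σ; ∃; _×_; _,_; proj₁; proj₂)
open import Data.Sum using (_⊎_; inj₁; inj₂; map₁) renaming (map to ⊎-map)
open import Data.Empty using (⊥; ⊥-elim)
open import Relation.Nullary using (¬_; Dec; yes; no; contradiction)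
open import Relation.Nullary.Decidable using (_×-dec_; ¬?; decidable-stable; ⌊_⌋)
open import Data.Nat.Tactic.RingSolver using (solve-∀)
open import Relation.Unary using (Pred; Decidable)
open import Data.Maybe using (just; nothing; is-nothing)
import Data.Maybe.Properties as Maybe
open import Relation.Binary.PropositionalEquality
open import Relation.Binary.Construct.Closure.ReflexiveTransitive using (Star; ε; _◅_; _◅◅_; reverse)
open import Function.Definitions using (Injective)

∣p∪q∣≤∣p∣+∣q∣ : ∀ {n} (p q : Subset n) → ∣ p ∪ q ∣ ≤ ∣ p ∣ + ∣ q ∣
∣p∪q∣≤∣p∣+∣q∣ []            []            = z≤n
∣p∪q∣≤∣p∣+∣q∣ (outside ∷ p) (outside ∷ q) = ∣p∪q∣≤∣p∣+∣q∣ p q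
∣p∪q∣≤∣p∣+∣q∣ (outside ∷ p) (inside  ∷ q) =
  subst (suc ∣ p ∪ q ∣ ≤_) (sym (+-suc ∣ p ∣ ∣ q ∣)) (s≤s (∣p∪q∣≤∣p∣+∣q∣ p q))
∣p∪q∣≤∣p∣+∣q∣ (inside  ∷ p) (outside ∷ q) = s≤s (∣p∪q∣≤∣p∣+∣q∣ p q)
∣p∪q∣≤∣p∣+∣q∣ (inside  ∷ p) (inside  ∷ q) = s≤s (≤-trans (∣p∪q∣≤∣p∣+∣q∣ p q) (+-monoʳ-≤ ∣ p ∣ (n≤1+n ∣ q ∣)))

union-bound : ∀ {n} {S T U : Subset n} → (∀ {x} → x ∈ S → x ∈ T ⊎ x ∈ U) → ∣ S ∣ ≤ ∣ T ∣ + ∣ U ∣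
union-bound {T = T} {U} cover = ≤-trans (p⊆q⇒∣p∣≤∣q∣ (λ x∈S → x∈p∪q⁺ (cover x∈S))) (∣p∪q∣≤∣p∣+∣q∣ T U)

∈-tabulate⁺ : ∀ {n} {f : Fin n → Bool} {x} → f x ≡ true → x ∈ tabulate f
∈-tabulate⁺ {f = f} {x} fx = lookup⇒[]= x (tabulate f) (trans (lookup∘tabulate f x) fx)

x∈p─q⁻ : ∀ {n} (p q : Subset n) {x} → x ∈ p ─ q → x ∈ p × x ∉ q
x∈p─q⁻ (inside ∷ p) (outside ∷ q) headᵛ = headᵛ , λ ()
x∈p─q⁻ (inside ∷ p) (inside ∷ q) {zero} ()
x∈p─q⁻ (outside ∷ p) (inside ∷ q) {zero} ()
x∈p─q⁻ (outside ∷ p) (outside ∷ q) {zero} ()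
x∈p─q⁻ (s ∷ p) (t ∷ q) (tailᵛ x∈p─q) with x∈p─q⁻ p q x∈p─q
... | x∈p , x∉q = tailᵛ x∈p , λ { (tailᵛ x∈q) → x∉q x∈q }

∣p∣≡∣p─q∣+∣p∩q∣ : ∀ {n} (p q : Subset n) → ∣ p ∣ ≡ ∣ p ─ q ∣ + ∣ p ∩ q ∣
∣p∣≡∣p─q∣+∣p∩q∣ []            []            = refl
∣p∣≡∣p─q∣+∣p∩q∣ (outside ∷ p) (outside ∷ q) = ∣p∣≡∣p─q∣+∣p∩q∣ p q
∣p∣≡∣p─q∣+∣p∩q∣ (outside ∷ p) (inside  ∷ q) = ∣p∣≡∣p─q∣+∣p∩q∣ p q
∣p∣≡∣p─q∣+∣p∩q∣ (inside  ∷ p) (outside ∷ q) = cong suc (∣p∣≡∣p─q∣+∣p∩q∣ p q)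
∣p∣≡∣p─q∣+∣p∩q∣ (inside  ∷ p) (inside  ∷ q) =
  trans (cong suc (∣p∣≡∣p─q∣+∣p∩q∣ p q)) (sym (+-suc ∣ p ─ q ∣ ∣ p ∩ q ∣))

nonempty-if-pos : ∀ {n} (p : Subset n) → 0 < ∣ p ∣ → Nonempty p
nonempty-if-pos {n} p pos with nonempty? p
... | yes nonempty = nonempty
... | no  empty    = contradiction (trans (cong ∣_∣ (Empty-unique empty)) (∣⊥∣≡0 n)) (>⇒≢ pos)

listSet : ∀ {n} → List (Fin n) → Subset n
listSet = foldr (λ x S → ⁅ x ⁆ ∪ S) ∅

∈-listSet⁺ : ∀ {n} {x : Fin n} {xs} → x ∈ₗ xs → x ∈ listSet xs
∈-listSet⁺ {x = x} (here refl) = x∈p∪q⁺ (inj₁ (x∈⁅x⁆ x))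
∈-listSet⁺ (there x∈xs)        = x∈p∪q⁺ (inj₂ (∈-listSet⁺ x∈xs))

∣listSet∣≤length : ∀ {n} (xs : List (Fin n)) → ∣ listSet xs ∣ ≤ length xs
∣listSet∣≤length {n} []       = ≤-reflexive (∣⊥∣≡0 n)
∣listSet∣≤length     (x ∷ xs) = begin
  ∣ ⁅ x ⁆ ∪ listSet xs ∣      ≤⟨ ∣p∪q∣≤∣p∣+∣q∣ ⁅ x ⁆ (listSet xs) ⟩
  ∣ ⁅ x ⁆ ∣ + ∣ listSet xs ∣  ≡⟨ cong (_+ ∣ listSet xs ∣) (∣⁅x⁆∣≡1 x) ⟩
  suc ∣ listSet xs ∣          ≤⟨ s≤s (∣listSet∣≤length xs) ⟩
  suc (length xs)             ∎
  where open ≤-Reasoning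

list-bound : ∀ {n} {S : Subset n} (xs : List (Fin n)) → (∀ {x} → x ∈ S → x ∈ₗ xs) → ∣ S ∣ ≤ length xs
list-bound xs cover = ≤-trans (p⊆q⇒∣p∣≤∣q∣ (λ x∈S → ∈-listSet⁺ (cover x∈S))) (∣listSet∣≤length xs)

cover-bound : ∀ {n} {S U : Subset n} (xs : List (Fin n)) →
              (∀ {x} → x ∈ S → x ∈ₗ xs ⊎ x ∈ U) → ∣ S ∣ ≤ length xs + ∣ U ∣
cover-bound {U = U} xs cover =
  ≤-trans (union-bound (λ x∈S → map₁ ∈-listSet⁺ (cover x∈S))) (+-monoˡ-≤ ∣ U ∣ (∣listSet∣≤length xs))

cover? : ∀ {n p} {P : Pred (Fin n) p} → Decidable P → (xs : List (Fin n)) →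
         (∀ {x} → P x → x ∈ₗ xs) ⊎ ∃ λ x → P x × x ∉ₗ xs
cover? P? xs with any? (λ x → P? x ×-dec ¬? (anyₗ? (x ≟ᶠ_) xs))
... | yes (x , px , x∉xs) = inj₂ (x , px , x∉xs)
... | no  none            = inj₁ λ {x} px → decidable-stable (anyₗ? (x ≟ᶠ_) xs) (λ x∉xs → none (x , px , x∉xs))

length-filter-disjoint : ∀ {a p q} {A : Set a} {P : Pred A p} {Q : Pred A q}
  (P? : Decidable P) (Q? : Decidable Q) (xs : List A) → All (λ x → ¬ (P x × Q x)) xs →
  length (filter P? xs) + length (filter Q? xs) ≤ length xs
length-filter-disjoint P? Q? []       []          = z≤n
length-filter-disjoint P? Q? (x ∷ xs) (¬PQx ∷ ¬PQ) with P? x | Q? x | length-filter-disjoint P? Q? xs ¬PQ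
... | yes Px | yes Qx | _  = contradiction (Px , Qx) ¬PQx
... | yes _  | no  _  | ih = s≤s ih
... | no  _  | yes _  | ih = subst (_≤ suc (length xs)) (sym (+-suc _ _)) (s≤s ih)
... | no  _  | no  _  | ih = m≤n⇒m≤1+n ih

∈-from-front : ∀ {A : Set} (xs : List A) {x y zs} → x ∈ₗ y ∷ xs ++ zs → x ∈ₗ xs ++ y ∷ zs
∈-from-front xs (here refl) = ∈-++⁺ʳ xs (here refl)
∈-from-front xs (there x∈) with ∈-++⁻ xs x∈
... | inj₁ x∈xs = ∈-++⁺ˡ x∈xs
... | inj₂ x∈zs = ∈-++⁺ʳ xs (there x∈zs)

unique-to-front : ∀ {A : Set} (xs : List A) {y zs} → Unique (xs ++ y ∷ zs) → Unique (y ∷ xs ++ zs)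
unique-to-front []       u            = u
unique-to-front (x ∷ xs) (x∉ ∷ u) with unique-to-front xs u | All-++⁻ xs x∉
... | y∉ ∷ u′ | x∉xs , x≢y ∷ x∉zs = ((λ y≡x → x≢y (sym y≡x)) ∷ y∉) ∷ (All-++⁺ x∉xs x∉zs ∷ u′)

fresh-cons : ∀ {A : Set} {x : A} {xs} → x ∉ₗ xs → Unique xs → Unique (x ∷ xs)
fresh-cons x∉ u = ¬Any⇒All¬ _ x∉ ∷ u

fresh-second : ∀ {A : Set} {x y : A} {zs} → x ∉ₗ y ∷ zs → Unique (y ∷ zs) → Unique (y ∷ x ∷ zs)
fresh-second x∉ (y∉ ∷ u) = ((λ y≡x → x∉ (here (sym y≡x))) ∷ y∉) ∷ fresh-cons (λ x∈ → x∉ (there x∈)) u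

covered⁻ : ∀ {n} {x : Fin n} (M : List (Fin n × Fin n)) → x ∈ₗ covered M → x ∈ₗ map proj₁ M ⊎ x ∈ₗ map proj₂ M
covered⁻ ((u , v) ∷ M) (here x≡u)           = inj₁ (here x≡u)
covered⁻ ((u , v) ∷ M) (there (here x≡v))   = inj₂ (here x≡v)
covered⁻ ((u , v) ∷ M) (there (there x∈M)) with covered⁻ M x∈M
... | inj₁ x∈₁ = inj₁ (there x∈₁)
... | inj₂ x∈₂ = inj₂ (there x∈₂)

covered-unique : ∀ {n} (M : List (Fin n × Fin n)) → Unique (map proj₁ M) → Unique (map proj₂ M) →
                 (∀ {x} → x ∈ₗ map proj₁ M → x ∉ₗ map proj₂ M) → Unique (covered M)
covered-unique []            _          _          _     = []
covered-unique ((u , v) ∷ M) (u∉ ∷ U₁) (v∉ ∷ U₂) apart =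
  fresh-cons u-fresh (fresh-cons v-fresh (covered-unique M U₁ U₂ λ x∈₁ x∈₂ → apart (there x∈₁) (there x∈₂)))
  where
  v-fresh : v ∉ₗ covered M
  v-fresh v∈ with covered⁻ M v∈
  ... | inj₁ v∈₁ = apart (there v∈₁) (here refl)
  ... | inj₂ v∈₂ = All¬⇒¬Any v∉ v∈₂
  u-fresh : u ∉ₗ v ∷ covered M
  u-fresh (here refl) = apart (here refl) (here refl)
  u-fresh (there u∈) with covered⁻ M u∈
  ... | inj₁ u∈₁ = All¬⇒¬Any u∉ u∈₁
  ... | inj₂ u∈₂ = apart (here refl) (there u∈₂)

-- Fin 3 has no four distinct elements, so a colour avoiding two distinct colours is unique.
third-unique : ∀ {i j c k : Fin 3} → i ≢ j → c ≢ i → c ≢ j → k ≢ i → k ≢ j → c ≡ k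
third-unique {i} {j} {c} {k} i≢j c≢i c≢j k≢i k≢j with c ≟ᶠ k
... | yes c≡k = c≡k
... | no  c≢k = contradiction (injective⇒≤ injective) λ { (s≤s (s≤s (s≤s ()))) }
  where
  colour : Fin 4 → Fin 3
  colour = lookup (i ∷ j ∷ c ∷ k ∷ [])
  injective : Injective _≡_ _≡_ colour
  injective {zero}                {zero}                _ = refl
  injective {zero}                {suc zero}            e = contradiction e i≢j
  injective {zero}                {suc (suc zero)}      e = contradiction (sym e) c≢i
  injective {zero}                {suc (suc (suc zero))} e = contradiction (sym e) k≢i
  injective {suc zero}            {zero}                e = contradiction (sym e) i≢j
  injective {suc zero}            {suc zero}            _ = refl
  injective {suc zero}            {suc (suc zero)}      e = contradiction (sym e) c≢j
  injective {suc zero}            {suc (suc (suc zero))} e = contradiction (sym e) k≢j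
  injective {suc (suc zero)}      {zero}                e = contradiction e c≢i
  injective {suc (suc zero)}      {suc zero}            e = contradiction e c≢j
  injective {suc (suc zero)}      {suc (suc zero)}      _ = refl
  injective {suc (suc zero)}      {suc (suc (suc zero))} e = contradiction e c≢k
  injective {suc (suc (suc zero))} {zero}               e = contradiction e k≢i
  injective {suc (suc (suc zero))} {suc zero}           e = contradiction e k≢j
  injective {suc (suc (suc zero))} {suc (suc zero)}     e = contradiction (sym e) c≢k
  injective {suc (suc (suc zero))} {suc (suc (suc zero))} _ = refl

third-colour : (i j : Fin 3) → i ≢ j → ∃ λ k → k ≢ i × k ≢ j
third-colour zero             zero             i≢j = contradiction refl i≢j
third-colour zero             (suc zero)       _   = suc (suc zero) , (λ ()) , (λ ())
third-colour zero             (suc (suc zero)) _   = suc zero , (λ ()) , (λ ())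
third-colour (suc zero)       zero             _   = suc (suc zero) , (λ ()) , (λ ())
third-colour (suc zero)       (suc zero)       i≢j = contradiction refl i≢j
third-colour (suc zero)       (suc (suc zero)) _   = zero , (λ ()) , (λ ())
third-colour (suc (suc zero)) zero             _   = suc zero , (λ ()) , (λ ())
third-colour (suc (suc zero)) (suc zero)       _   = zero , (λ ()) , (λ ())
third-colour (suc (suc zero)) (suc (suc zero)) i≢j = contradiction refl i≢j

-- Monochromatic components

edge? : ∀ {N} (G : ColouredGraph N) k u v → Dec (Edge G k u v)
edge? G k u v = Maybe.≡-dec _≟ᶠ_ (col G u v) (just k)

edge-sym : ∀ {N} (G : ColouredGraph N) k {u v} → Edge G k u v → Edge G k v u
edge-sym G k {u} {v} e = trans (ColouredGraph.sym G v u) e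

closed-reach : ∀ {n} {E : Fin n → Fin n → Set} {S : Subset n} →
               (∀ u v → u ∈ S → E u v → v ∈ S) → ∀ {u v} → u ∈ S → Star E u v → v ∈ S
closed-reach closed u∈S ε        = u∈S
closed-reach closed u∈S (e ◅ es) = closed-reach closed (closed _ _ u∈S e) es

∣p∣<∣p∪⁅x⁆∣ : ∀ {n} {p : Subset n} {x} → x ∉ p → ∣ p ∣ < ∣ p ∪ ⁅ x ⁆ ∣
∣p∣<∣p∪⁅x⁆∣ {p = p} {x} x∉p =
  p⊂q⇒∣p∣<∣q∣ ((λ y∈p → x∈p∪q⁺ (inj₁ y∈p)) , x , x∈p∪q⁺ (inj₂ (x∈⁅x⁆ x)) , x∉p)

-- The colour-k component of a vertex s, computed by repeatedly adding a vertex joined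
-- to the current set by a colour-k edge; each set is reachable from s, and the process
-- stops within N steps because the set grows every time.
module ComponentOf {N} (G : ColouredGraph N) (k : Fin 3) (s : Fin N) where

  Closed : Subset N → Set
  Closed S = ∀ u v → u ∈ S → Edge G k u v → v ∈ S

  Reachable : Subset N → Set
  Reachable S = ∀ {v} → v ∈ S → Star (Edge G k) s v

  exit? : (S : Subset N) → Closed S ⊎ ∃ λ u → ∃ λ v → u ∈ S × Edge G k u v × v ∉ S
  exit? S with any? (λ u → any? (λ v → u ∈? S ×-dec edge? G k u v ×-dec ¬? (v ∈? S)))
  ... | yes (u , v , u∈S , e , v∉S) = inj₂ (u , v , u∈S , e , v∉S)
  ... | no  none = inj₁ λ u v u∈S e → decidable-stable (v ∈? S) λ v∉S → none (u , v , u∈S , e , v∉S)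

  -- Enlarge a set reachable from s until it is closed; fuel + |S| ≥ N guarantees enough steps.
  grow : ∀ fuel (S : Subset N) → s ∈ S → Reachable S → N ≤ fuel + ∣ S ∣ →
         Σ (Subset N) λ S → s ∈ S × Closed S × Reachable S
  grow fuel S s∈S reach bound with exit? S
  ... | inj₁ closed = S , s∈S , closed , reach
  grow zero S _ _ bound | inj₂ (_ , v , _ , _ , v∉S) =
    contradiction (≤-trans (∣p∣≤n (S ∪ ⁅ v ⁆)) bound) (<⇒≱ (∣p∣<∣p∪⁅x⁆∣ v∉S))
  grow (suc fuel) S s∈S reach bound | inj₂ (u , v , u∈S , e , v∉S) =
    grow fuel (S ∪ ⁅ v ⁆) (x∈p∪q⁺ (inj₁ s∈S)) reach′
         (≤-trans bound (subst (_≤ fuel + ∣ S ∪ ⁅ v ⁆ ∣) (+-suc fuel ∣ S ∣) (+-monoʳ-≤ fuel (∣p∣<∣p∪⁅x⁆∣ v∉S))))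
    where
    reach′ : Reachable (S ∪ ⁅ v ⁆)
    reach′ {x} x∈ with x∈p∪q⁻ S ⁅ v ⁆ x∈
    ... | inj₁ x∈S = reach x∈S
    ... | inj₂ x∈v rewrite x∈⁅y⁆⇒x≡y v x∈v = reach u∈S ◅◅ (e ◅ ε)

  component : Σ (Subset N) λ S → IsMonoComponent G k S × s ∈ S
  component with grow N ⁅ s ⁆ (x∈⁅x⁆ s) (λ x∈ → subst (Star (Edge G k) s) (sym (x∈⁅y⁆⇒x≡y s x∈)) ε) (m≤m+n N _)
  ... | S , s∈S , closed , reach =
    S , ((s , s∈S) , closed , λ u v u∈S v∈S → reverse (edge-sym G k) (reach u∈S) ◅◅ reach v∈S) , s∈S

neighbour-or-non : ∀ {N} (G : ColouredGraph N) {k v x} → x ≢ v →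
                   col G v x ≡ nothing ⊎ Edge G k v x → Edge G k v x ⊎ x ∈ nonNbrs G v
neighbour-or-non G _ (inj₂ e) = inj₁ e
neighbour-or-non G {v = v} {x} x≢v (inj₁ no-edge) = inj₂ (∈-tabulate⁺ (non-neighbour (x ≟ᶠ v)))
  where
  non-neighbour : (d : Dec (x ≡ v)) → not ⌊ d ⌋ ∧ is-nothing (col G v x) ≡ true
  non-neighbour (yes x≡v) = contradiction x≡v x≢v
  non-neighbour (no  _)   rewrite no-edge = refl

two-nonNbrs : ∀ {N} (G : ColouredGraph N) → Dense8 G → ∀ u v → 4 * (∣ nonNbrs G u ∣ + ∣ nonNbrs G v ∣) < N
two-nonNbrs G dense u v = ≰⇒> λ N≤ → <⇒≱ (+-mono-< (dense u) (dense v)) (≤-trans (+-mono-≤ N≤ N≤)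
  (≤-reflexive (double-quarter ∣ nonNbrs G u ∣ ∣ nonNbrs G v ∣)))
  where
  double-quarter : ∀ x y → 4 * (x + y) + 4 * (x + y) ≡ 8 * x + 8 * y
  double-quarter = solve-∀

quarters-contradiction : ∀ {N} x y m d → N ≤ 4 * x → N ≤ 4 * y → x + y ≤ m + d → 4 * m < N → 4 * d < N → ⊥
quarters-contradiction {N} x y m d N≤4x N≤4y x+y≤ 4m<N 4d<N = <⇒≱ (+-mono-< 4m<N 4d<N) (begin
  N + N           ≤⟨ +-mono-≤ N≤4x N≤4y ⟩
  4 * x + 4 * y   ≡⟨ *-distribˡ-+ 4 x y ⟨
  4 * (x + y)     ≤⟨ *-monoʳ-≤ 4 x+y≤ ⟩
  4 * (m + d)     ≡⟨ *-distribˡ-+ 4 m d ⟩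
  4 * m + 4 * d   ∎)
  where open ≤-Reasoning

-- If |A| ≥ N/2 and |A ∖ B| < N/4, then |A ∩ B| > N/4 (here z = |A ∖ B|, m = |A ∩ B|).
one-part-small : ∀ {N} z m → N ≤ 2 * (z + m) → 4 * z < N → N < 4 * m
one-part-small {N} z m N≤2[z+m] 4z<N = ≰⇒> λ 4m≤N → <⇒≱ (+-mono-<-≤ 4z<N 4m≤N) (begin
  N + N                    ≤⟨ +-mono-≤ N≤2[z+m] N≤2[z+m] ⟩
  2 * (z + m) + 2 * (z + m) ≡⟨ double-half z m ⟩
  4 * z + 4 * m            ∎)
  where
  open ≤-Reasoning
  double-half : ∀ z m → 2 * (z + m) + 2 * (z + m) ≡ 4 * z + 4 * m
  double-half = solve-∀

-- Hence if |A|, |B| ≥ N/2 and the smaller of |A ∖ B|, |B ∖ A| is below N/4, then |A ∩ B| > N/4.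
overlap-arithmetic : ∀ {N} x y m → N ≤ 2 * (x + m) → N ≤ 2 * (y + m) → 4 * (x ⊓ y) < N → N < 4 * m
overlap-arithmetic {N} x y m N≤2[x+m] N≤2[y+m] small with ⊓-sel x y
... | inj₁ x⊓y≡x = one-part-small x m N≤2[x+m] (subst (λ z → 4 * z < N) x⊓y≡x small)
... | inj₂ x⊓y≡y = one-part-small y m N≤2[y+m] (subst (λ z → 4 * z < N) x⊓y≡y small)

-- Matchings across a bipartition

module CrossMatching {N} (G : ColouredGraph N) (dense : Dense8 G) (k : Fin 3) (A B : Subset N)
  (disjoint : ∀ {x} → x ∈ A → x ∉ B)
  (cross : ∀ {a b} → a ∈ A → b ∈ B → col G a b ≡ nothing ⊎ Edge G k a b)
  (N≤4∣A∣ : N ≤ 4 * ∣ A ∣) (N≤4∣B∣ : N ≤ 4 * ∣ B ∣) where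

  E : Fin N → Fin N → Set
  E = Edge G k

  seenᴬ : ∀ {a x} → a ∈ A → x ∈ B → E a x ⊎ x ∈ nonNbrs G a
  seenᴬ a∈A x∈B = neighbour-or-non G (λ { refl → disjoint a∈A x∈B }) (cross a∈A x∈B)

  seenᴮ : ∀ {b x} → b ∈ B → x ∈ A → E b x ⊎ x ∈ nonNbrs G b
  seenᴮ {b} {x} b∈B x∈A = neighbour-or-non G (λ { refl → disjoint x∈A b∈B }) flipped
    where
    flipped : col G b x ≡ nothing ⊎ E b x
    flipped = ⊎-map (trans (ColouredGraph.sym G b x)) (edge-sym G k) (cross x∈A b∈B)

  -- Two vertices of A have a common colour-k neighbour: B has at least N/4 vertices,
  -- more than the non-neighbours of both together.
  common-neighbour : ∀ {a a′} → a ∈ A → a′ ∈ A → ∃ λ x → E a x × E a′ x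
  common-neighbour {a} {a′} a∈A a′∈A with any? (λ x → x ∈? B ×-dec edge? G k a x ×-dec edge? G k a′ x)
  ... | yes (x , _ , e , e′) = x , e , e′
  ... | no  none = contradiction (≤-trans N≤4∣B∣ (*-monoʳ-≤ 4 (union-bound non-neighbour)))
                                 (<⇒≱ (two-nonNbrs G dense a a′))
    where
    non-neighbour : ∀ {x} → x ∈ B → x ∈ nonNbrs G a ⊎ x ∈ nonNbrs G a′
    non-neighbour x∈B with seenᴬ a∈A x∈B | seenᴬ a′∈A x∈B
    ... | inj₁ e | inj₁ e′ = contradiction (_ , x∈B , e , e′) none
    ... | inj₂ x∉ | _      = inj₁ x∉
    ... | inj₁ _ | inj₂ x∉ = inj₂ x∉

  A-connected : ∀ {a a′} → a ∈ A → a′ ∈ A → Star E a a′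
  A-connected a∈A a′∈A with common-neighbour a∈A a′∈A
  ... | x , e , e′ = e ◅ edge-sym G k e′ ◅ ε

  CrossEdge : Fin N × Fin N → Set
  CrossEdge (a , b) = a ∈ A × b ∈ B × E a b

  record CrossMatching (M : List (Fin N × Fin N)) : Set where
    field
      edges     : All CrossEdge M
      distinctᴬ : Unique (map proj₁ M)
      distinctᴮ : Unique (map proj₂ M)
  open CrossMatching

  extend : ∀ {M a b} → CrossMatching M → a ∈ A → b ∈ B → E a b →
           a ∉ₗ map proj₁ M → b ∉ₗ map proj₂ M → CrossMatching ((a , b) ∷ M)
  extend m a∈A b∈B e a-free b-free = record
    { edges     = (a∈A , b∈B , e) ∷ edges m
    ; distinctᴬ = fresh-cons a-free (distinctᴬ m)
    ; distinctᴮ = fresh-cons b-free (distinctᴮ m)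
    }

  exchange : ∀ M₁ M₂ {a b a′ b′} → CrossMatching (M₁ ++ (a′ , b′) ∷ M₂) → a ∈ A → b ∈ B →
             a ∉ₗ map proj₁ (M₁ ++ (a′ , b′) ∷ M₂) → b ∉ₗ map proj₂ (M₁ ++ (a′ , b′) ∷ M₂) →
             E a b′ → E a′ b → CrossMatching ((a′ , b) ∷ (a , b′) ∷ M₁ ++ M₂)
  exchange M₁ M₂ {a} {b} {a′} {b′} m a∈A b∈B a-free b-free ab′ a′b
    with All-++⁻ M₁ (edges m)
  ... | edges₁ , (a′∈A , b′∈B , _) ∷ edges₂ = record
    { edges     = (a′∈A , b∈B , a′b) ∷ (a∈A , b′∈B , ab′) ∷ All-++⁺ edges₁ edges₂
    ; distinctᴬ = subst Unique (cong (λ l → a′ ∷ a ∷ l) (sym (map-++ proj₁ M₁ M₂)))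
                    (fresh-second (a-free ∘ ∈-map₁ ∘ ∈-from-front (map proj₁ M₁))
                                  (unique-to-front (map proj₁ M₁) (split₁ (distinctᴬ m))))
    ; distinctᴮ = subst Unique (cong (λ l → b ∷ b′ ∷ l) (sym (map-++ proj₂ M₁ M₂)))
                    (fresh-cons (b-free ∘ ∈-map₂ ∘ ∈-from-front (map proj₂ M₁))
                                (unique-to-front (map proj₂ M₁) (split₂ (distinctᴮ m))))
    }
    where
    split₁ : Unique (map proj₁ (M₁ ++ (a′ , b′) ∷ M₂)) → Unique (map proj₁ M₁ ++ a′ ∷ map proj₁ M₂)
    split₁ = subst Unique (map-++ proj₁ M₁ _)
    split₂ : Unique (map proj₂ (M₁ ++ (a′ , b′) ∷ M₂)) → Unique (map proj₂ M₁ ++ b′ ∷ map proj₂ M₂)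
    split₂ = subst Unique (map-++ proj₂ M₁ _)
    ∈-map₁ : ∀ {x} → x ∈ₗ map proj₁ M₁ ++ a′ ∷ map proj₁ M₂ → x ∈ₗ map proj₁ (M₁ ++ (a′ , b′) ∷ M₂)
    ∈-map₁ = subst (_ ∈ₗ_) (sym (map-++ proj₁ M₁ _))
    ∈-map₂ : ∀ {x} → x ∈ₗ map proj₂ M₁ ++ b′ ∷ map proj₂ M₂ → x ∈ₗ map proj₂ (M₁ ++ (a′ , b′) ∷ M₂)
    ∈-map₂ = subst (_ ∈ₗ_) (sym (map-++ proj₂ M₁ _))

  matched-neighbours : ∀ {v} {S : Subset N} (π : Fin N × Fin N → Fin N) M →
    (∀ {x} → x ∈ S → E v x ⊎ x ∈ nonNbrs G v) → (∀ {x} → x ∈ S × E v x → x ∈ₗ map π M) →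
    ∣ S ∣ ≤ length (filter (λ p → edge? G k v (π p)) M) + ∣ nonNbrs G v ∣
  matched-neighbours {v} {S} π M seen matched =
    subst (λ l → ∣ S ∣ ≤ l + ∣ nonNbrs G v ∣) (length-map π (filter nbr? M)) (cover-bound (map π (filter nbr? M)) place)
    where
    nbr? : Decidable (λ p → E v (π p))
    nbr? p = edge? G k v (π p)
    place : ∀ {x} → x ∈ S → x ∈ₗ map π (filter nbr? M) ⊎ x ∈ nonNbrs G v
    place x∈S with seen x∈S
    ... | inj₂ x-non = inj₂ x-non
    ... | inj₁ e with ∈-map⁻ π (matched (x∈S , e))
    ...   | p , p∈M , refl = inj₁ (∈-map∘filter⁺ π nbr? (p , p∈M , refl , e))

  -- When a ∈ A and b ∈ B admit neither an extension nor an exchange, counting their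
  -- neighbours along the matching shows |A| + |B| ≤ |M| + (non-neighbours of a and of b).
  stuck-count : ∀ {a b} M → a ∈ A → b ∈ B →
    (∀ {x} → x ∈ B × E a x → x ∈ₗ map proj₂ M) → (∀ {x} → x ∈ A × E b x → x ∈ₗ map proj₁ M) →
    All (λ p → ¬ (E a (proj₂ p) × E b (proj₁ p))) M →
    ∣ A ∣ + ∣ B ∣ ≤ length M + (∣ nonNbrs G a ∣ + ∣ nonNbrs G b ∣)
  stuck-count {a} {b} M a∈A b∈B a-matched b-matched no-exchange = begin
    ∣ A ∣ + ∣ B ∣
      ≤⟨ +-mono-≤ (matched-neighbours proj₁ M (seenᴮ b∈B) b-matched)
                  (matched-neighbours proj₂ M (seenᴬ a∈A) a-matched) ⟩
    (length toA + nb) + (length toB + na)  ≡⟨ rearrange (length toA) nb (length toB) na ⟩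
    (length toB + length toA) + (na + nb)  ≤⟨ +-monoˡ-≤ (na + nb) (length-filter-disjoint _ _ M no-exchange) ⟩
    length M + (na + nb)                   ∎
    where
    open ≤-Reasoning
    na nb : ℕ
    na = ∣ nonNbrs G a ∣
    nb = ∣ nonNbrs G b ∣
    toA toB : List (Fin N × Fin N)
    toA = filter (λ p → edge? G k b (proj₁ p)) M
    toB = filter (λ p → edge? G k a (proj₂ p)) M
    rearrange : ∀ x y z w → (x + y) + (z + w) ≡ (z + x) + (w + y)
    rearrange = solve-∀

  unmatched : ∀ {S} (π : Fin N × Fin N → Fin N) M → N ≤ 4 * ∣ S ∣ → 4 * length M < N →
              ∃ λ x → x ∈ S × x ∉ₗ map π M
  unmatched {S} π M N≤4∣S∣ small with cover? (_∈? S) (map π M)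
  ... | inj₂ missing = missing
  ... | inj₁ covered = contradiction (≤-trans N≤4∣S∣ (*-monoʳ-≤ 4 ∣S∣≤∣M∣)) (<⇒≱ small)
    where
    ∣S∣≤∣M∣ : ∣ S ∣ ≤ length M
    ∣S∣≤∣M∣ = subst (∣ S ∣ ≤_) (length-map π M) (list-bound (map π M) covered)

  -- A cross matching with fewer than N/4 edges can be enlarged by one edge: pick unmatched
  -- a ∈ A and b ∈ B; extend by an edge at a or at b, or else exchange along a matching edge;
  -- if neither is possible, stuck-count contradicts the density.
  augment : ∀ M → CrossMatching M → 4 * length M < N →
            Σ (List (Fin N × Fin N)) λ M′ → CrossMatching M′ × length M′ ≡ suc (length M)
  augment M m small
    with unmatched proj₁ M N≤4∣A∣ small | unmatched proj₂ M N≤4∣B∣ small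
  ... | a , a∈A , a-free | b , b∈B , b-free
    with cover? (λ x → x ∈? B ×-dec edge? G k a x) (map proj₂ M)
       | cover? (λ x → x ∈? A ×-dec edge? G k b x) (map proj₁ M)
  ... | inj₂ (x , (x∈B , ax) , x-free) | _ = (a , x) ∷ M , extend m a∈A x∈B ax a-free x-free , refl
  ... | inj₁ _ | inj₂ (x , (x∈A , bx) , x-free) =
    (x , b) ∷ M , extend m x∈A b∈B (edge-sym G k bx) x-free b-free , refl
  ... | inj₁ a-matched | inj₁ b-matched
    with anyₗ? (λ p → edge? G k a (proj₂ p) ×-dec edge? G k b (proj₁ p)) M
  ... | no no-exchange = ⊥-elim (quarters-contradiction (∣ A ∣) (∣ B ∣) (length M) (∣ nonNbrs G a ∣ + ∣ nonNbrs G b ∣)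
    N≤4∣A∣ N≤4∣B∣ (stuck-count M a∈A b∈B a-matched b-matched (¬Any⇒All¬ M no-exchange)) small (two-nonNbrs G dense a b))
  ... | yes exchangeable with find exchangeable
  ... | (a′ , b′) , p∈M , ab′ , ba′ with ∈-∃++ p∈M
  ... | M₁ , M₂ , refl =
    (a′ , b) ∷ (a , b′) ∷ M₁ ++ M₂ ,
    exchange M₁ M₂ m a∈A b∈B a-free b-free ab′ (edge-sym G k ba′) ,
    cong suc (sym (length-++-sucʳ M₁ (a′ , b′) M₂))

  large-matching : Σ (List (Fin N × Fin N)) λ M → CrossMatching M × N ≤ 4 * length M
  large-matching = iterate N [] (record { edges = [] ; distinctᴬ = [] ; distinctᴮ = [] }) (m≤m+n N 0)
    where
    iterate : ∀ fuel M → CrossMatching M → N ≤ fuel + length M →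
              Σ (List (Fin N × Fin N)) λ M → CrossMatching M × N ≤ 4 * length M
    iterate fuel M m bound with 4 * length M <? N
    ... | no large = M , m , ≮⇒≥ large
    iterate zero M m bound | yes small =
      contradiction (≤-trans bound (m≤n*m (length M) 4)) (<⇒≱ small)
    iterate (suc fuel) M m bound | yes small with augment M m small
    ... | M′ , m′ , grew =
      iterate fuel M′ m′ (subst (N ≤_) (trans (sym (+-suc fuel (length M))) (cong (fuel +_) (sym grew))) bound)

  A-nonempty : Fin N → Nonempty A
  A-nonempty w = nonempty-if-pos A
    (≰⇒> λ ∣A∣≤0 → <⇒≱ (≤-<-trans z≤n (toℕ<n w)) (≤-trans N≤4∣A∣ (*-monoʳ-≤ 4 ∣A∣≤0)))

  -- The colour-k component of any vertex of A contains the whole large matching.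
  component-with-matching : Fin N → ∃ λ V₃ → IsMonoComponent G k V₃ × HasBigMatching G k V₃
  component-with-matching w with A-nonempty w | large-matching
  ... | s , s∈A | M , m , N≤4∣M∣ with ComponentOf.component G k s
  ... | V₃ , is-component@(_ , closed , _) , s∈V₃ =
    V₃ , is-component , M ,
    (All.map within (edges m) , covered-unique M (distinctᴬ m) (distinctᴮ m) apart) ,
    subst (N ≤_) (*-assoc 2 2 (length M)) N≤4∣M∣
    where
    within : ∀ {p} → CrossEdge p → E (proj₁ p) (proj₂ p) × proj₁ p ∈ V₃ × proj₂ p ∈ V₃
    within (a∈A , _ , e) = e , a∈V₃ , closed _ _ a∈V₃ e
      where a∈V₃ = closed-reach closed s∈V₃ (A-connected s∈A a∈A)
    apart : ∀ {x} → x ∈ₗ map proj₁ M → x ∉ₗ map proj₂ M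
    apart x∈₁ x∈₂ with ∈-map⁻ proj₁ x∈₁ | ∈-map⁻ proj₂ x∈₂
    ... | p , p∈M , refl | q , q∈M , x≡ =
      disjoint (proj₁ (All.lookup (edges m) p∈M)) (subst (_∈ B) (sym x≡) (proj₁ (proj₂ (All.lookup (edges m) q∈M))))

-- Two components of different colours

-- An edge between V₁ ∖ V₂ and V₂ ∖ V₁ cannot have colour i (its end in V₂ ∖ V₁ would lie in
-- the colour-i component V₁) nor colour j, so it has the remaining colour k.
cross-colour : ∀ {N} (G : ColouredGraph N) {i j k} → i ≢ j → k ≢ i → k ≢ j → {V₁ V₂ : Subset N} →
               IsMonoComponent G i V₁ → IsMonoComponent G j V₂ →
               ∀ {a b} → a ∈ V₁ ─ V₂ → b ∈ V₂ ─ V₁ → col G a b ≡ nothing ⊎ Edge G k a b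
cross-colour G {i} {j} i≢j k≢i k≢j {V₁} {V₂} (_ , closed₁ , _) (_ , closed₂ , _) {a} {b} a∈V₁─V₂ b∈V₂─V₁
  with x∈p─q⁻ V₁ V₂ a∈V₁─V₂ | x∈p─q⁻ V₂ V₁ b∈V₂─V₁ | col G a b in ab
... | _ | _ | nothing = inj₁ refl
... | a∈V₁ , a∉V₂ | b∈V₂ , b∉V₁ | just c with c ≟ᶠ i | c ≟ᶠ j
...   | yes refl | _     = contradiction (closed₁ a b a∈V₁ ab) b∉V₁
...   | _ | yes refl     = contradiction (closed₂ b a b∈V₂ (trans (ColouredGraph.sym G b a) ab)) a∉V₂
...   | no c≢i | no c≢j = inj₂ (cong just (third-unique i≢j c≢i c≢j k≢i k≢j))

-- First claim, for any three distinct colours i, j, k: if both V₁ ∖ V₂ and V₂ ∖ V₁ have at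
-- least N/4 vertices, the cross-matching argument applies to them with colour k.
matching-or-overlap : ∀ {N} (G : ColouredGraph N) → Dense8 G → ∀ {i j k} → i ≢ j → k ≢ i → k ≢ j →
  (V₁ V₂ : Subset N) → IsMonoComponent G i V₁ → IsMonoComponent G j V₂ →
  (∃ λ V₃ → IsMonoComponent G k V₃ × HasBigMatching G k V₃) ⊎ (4 * (∣ V₁ ─ V₂ ∣ ⊓ ∣ V₂ ─ V₁ ∣) < N)
matching-or-overlap {N} G dense {k = k} i≢j k≢i k≢j V₁ V₂ c₁ c₂ with 4 * (∣ V₁ ─ V₂ ∣ ⊓ ∣ V₂ ─ V₁ ∣) <? N
... | yes small = inj₂ small
... | no  large = inj₁ (CrossMatching.component-with-matching G dense k (V₁ ─ V₂) (V₂ ─ V₁) disjoint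
                          (cross-colour G i≢j k≢i k≢j c₁ c₂)
                          (≤-trans (≮⇒≥ large) (*-monoʳ-≤ 4 (m⊓n≤m ∣ V₁ ─ V₂ ∣ ∣ V₂ ─ V₁ ∣)))
                          (≤-trans (≮⇒≥ large) (*-monoʳ-≤ 4 (m⊓n≤n ∣ V₁ ─ V₂ ∣ ∣ V₂ ─ V₁ ∣)))
                          (proj₁ (proj₁ c₁)))
  where
  disjoint : ∀ {x} → x ∈ V₁ ─ V₂ → x ∉ V₂ ─ V₁
  disjoint x∈V₁─V₂ x∈V₂─V₁ = proj₂ (x∈p─q⁻ V₁ V₂ x∈V₁─V₂) (proj₁ (x∈p─q⁻ V₂ V₁ x∈V₂─V₁))

components-overlap : ∀ (N : ℕ) (G : ColouredGraph N) → Dense8 G →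
  (¬ ∃ (λ (i : Fin 3) → ∃ (λ V → IsMonoComponent G i V × HasBigMatching G i V))) →
  (i j : Fin 3) → i ≢ j → (A B : Subset N) →
  IsMonoComponent G i A → IsMonoComponent G j B →
  N ≤ 2 * ∣ A ∣ → N ≤ 2 * ∣ B ∣ → N < 4 * ∣ A ∩ B ∣
components-overlap N G dense no-big i j i≢j A B cA cB N≤2∣A∣ N≤2∣B∣ with third-colour i j i≢j
... | k , k≢i , k≢j with matching-or-overlap G dense i≢j k≢i k≢j A B cA cB
... | inj₁ (V₃ , c₃ , big) = contradiction (k , V₃ , c₃ , big) no-big
... | inj₂ small = overlap-arithmetic (∣ A ─ B ∣) (∣ B ─ A ∣) (∣ A ∩ B ∣)
                     (subst (λ s → N ≤ 2 * s) (∣p∣≡∣p─q∣+∣p∩q∣ A B) N≤2∣A∣) (subst (λ s → N ≤ 2 * s) ∣B∣≡ N≤2∣B∣) small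
  where
  ∣B∣≡ : ∣ B ∣ ≡ ∣ B ─ A ∣ + ∣ A ∩ B ∣
  ∣B∣≡ = trans (∣p∣≡∣p─q∣+∣p∩q∣ B A) (cong (λ S → ∣ B ─ A ∣ + ∣ S ∣) (∩-comm B A))

lemma2p3 : (∀ (N : ℕ) (G : ColouredGraph N) → Dense8 G →
               (V₁ V₂ : Subset N) →
               IsMonoComponent G zero V₁ → IsMonoComponent G (suc zero) V₂ →
               (∃ (λ V₃ → IsMonoComponent G (suc (suc zero)) V₃ × HasBigMatching G (suc (suc zero)) V₃))
               ⊎ (4 * (∣ V₁ ─ V₂ ∣ ⊓ ∣ V₂ ─ V₁ ∣) < N))
             × (∀ (N : ℕ) (G : ColouredGraph N) → Dense8 G →
               (¬ ∃ (λ (i : Fin 3) → ∃ (λ V → IsMonoComponent G i V × HasBigMatching G i V))) →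
               (i j : Fin 3) → i ≢ j → (A B : Subset N) →
               IsMonoComponent G i A → IsMonoComponent G j B →
               N ≤ 2 * ∣ A ∣ → N ≤ 2 * ∣ B ∣ →
               N < 4 * ∣ A ∩ B ∣)
lemma2p3 = (λ N G dense → matching-or-overlap G dense (λ ()) (λ ()) (λ ())) , components-overlap
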